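{- Let $m$ be a positive integer, $n$ an odd positive integer, $u\in\mathbb{F}_{2^m}$ and $v\in\mathbb{F}_{2^m}\setminus\{0,1\}$. Then the polynomial \[F(x)=x\left(u\,\mathrm{tr}_m^{nm}(x)+ux\right)+vx\] is a complete permutation polynomial over $\mathbb{F}_{2^{nm}}$.
   Context: A polynomial $f\in\mathbb{F}_Q[x]$ is a complete permutation polynomial over $\mathbb{F}_Q$ if both $f(x)$ and $f(x)+x$ induce bijections of $\mathbb{F}_Q$. For positive integers $s\mid r$, $\mathrm{tr}_s^r$ denotes the relative trace from $\mathbb{F}_{2^r}$ to $\mathbb{F}_{2^s}$, $\mathrm{tr}_s^r(x)=\sum_{i=0}^{r/s-1}x^{2^{si}}$. -}

module Defs where

open import Level using (0ℓ)
open import Algebra.Bundles using (CommutativeRing)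
open import Data.Nat as ℕ using (ℕ; zero; suc)
open import Data.Fin using (Fin)
open import Data.Product using (Σ; ∃; _×_)
open import Relation.Nullary using (¬_)
import Relation.Binary.PropositionalEquality

record Field : Set₁ where
  field
    commRing : CommutativeRing 0ℓ 0ℓ
  open CommutativeRing commRing public
  field
    1≉0 : ¬ (1# ≈ 0#)
    inverse : ∀ x → ¬ (x ≈ 0#) → ∃ λ y → x * y ≈ 1#

module _ (K : Field) where
  open Field K

  pow : Carrier → ℕ → Carrier
  pow x zero = 1#
  pow x (suc k) = x * pow x k

  HasCard : ℕ → Set
  HasCard q = Σ (Fin q → Carrier) λ e →
      (∀ i j → e i ≈ e j → i Relation.Binary.PropositionalEquality.≡ j)
    × (∀ x → ∃ λ i → e i ≈ x)

  InSubfield : ℕ → Carrier → Set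
  InSubfield m x = pow x (2 ℕ.^ m) ≈ x

  trace : ℕ → ℕ → Carrier → Carrier
  trace m zero x = 0#
  trace m (suc i) x = trace m i x + pow x (2 ℕ.^ (m ℕ.* i))

  IsPermutation : (Carrier → Carrier) → Set
  IsPermutation f = (∀ x y → f x ≈ f y → x ≈ y) × (∀ y → ∃ λ x → f x ≈ y)

  IsCompletePermutation : (Carrier → Carrier) → Set
  IsCompletePermutation f = IsPermutation f × IsPermutation (λ x → f x + x)

module Submission where

-- Write T = tr_M^{Mn} (M = m + 1) and G_w(x) = x(u·T(x) + u·x) + w·x, so that F = G_v and
-- F + id = G_{v+1}. The field has 2^{Mn} elements, so 2^{Mn}·1 = 0 forces characteristic 2, and
-- x^{2^{Mn}} = x; hence T takes values in F_{2^M}, is F_{2^M}-linear and satisfies T(x²) = T(x)².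
-- Consequently T(G_w(x)) = w·T(x), so G_w(x) = G_w(y) with w ≠ 0 gives T(x) = T(y), and then
-- G_w(x) + G_w(y) = (x + y)(u·T(x) + w + u·(x + y)). Taking traces of the vanishing of the second
-- factor (n odd, so T is the identity on F_{2^M}) yields u·T(x) + w = 0 = u·(x + y), which is
-- impossible for x ≠ y and w ≠ 0. Thus G_w is injective, hence bijective, for all nonzero
-- w ∈ F_{2^M}; apply this to w = v and w = v + 1.

open import Defs
open import Level using (0ℓ)
open import Algebra.Bundles using (CommutativeMonoid)
open import Data.Nat as ℕ using (ℕ; zero; suc)
import Data.Nat.Properties as ℕₚ
open import Data.Fin as Fin using (Fin)
import Data.Fin.Properties as Finₚ
open import Data.Fin.Permutation using (Permutation)
open import Data.Product using (∃; _,_; proj₁; proj₂)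
open import Data.Empty using (⊥; ⊥-elim)
open import Function.Base using (_∘_; id)
open import Function.Bundles using (mk↔ₛ′)
open import Relation.Nullary using (¬_; Dec; yes; no; contradiction)
open import Relation.Binary.PropositionalEquality as ≡ using (_≡_)
import Algebra.Properties.CommutativeMonoid.Sum as Sum
import Algebra.Properties.Ring as RingProperties
import Algebra.Properties.CommutativeSemiring.Exp as Exp
import Algebra.Properties.Semiring.Mult as Mult

injective⇒surjective : ∀ {n} (f : Fin n → Fin n) →
                       (∀ i j → f i ≡ f j → i ≡ j) → ∀ j → ∃ λ i → f i ≡ j
injective⇒surjective {suc n} f f-injective j with Finₚ.any? (λ i → f i Finₚ.≟ j)
... | yes hit = hit
... | no miss = contradiction (Finₚ.injective⇒≤ g-injective) ℕₚ.1+n≰n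
  where
  g : Fin (suc n) → Fin n
  g i = Fin.punchOut {i = j} {j = f i} (λ j≡fi → miss (i , ≡.sym j≡fi))
  g-injective : ∀ {a b} → g a ≡ g b → a ≡ b
  g-injective {a} {b} = f-injective a b ∘ Finₚ.punchOut-injective {i = j} _ _

module _ (K : Field) where
  open Field K
  open RingProperties ring using (+-cancelʳ; +-identityˡ-unique)
  open Exp commutativeSemiring using (_^_; ^-congˡ; ^-distrib-*; ^-assocʳ)
  open Mult semiring using (_×_; ×1-homo-*)
  open import Algebra.Solver.Ring.NaturalCoefficients.Default commutativeSemiring
  open import Relation.Binary.Reasoning.Setoid setoid
  module ∑ = Sum +-commutativeMonoid
  module ∏ = Sum *-commutativeMonoid

  pow≡^ : ∀ x n → pow K x n ≡ x ^ n
  pow≡^ x zero = ≡.refl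
  pow≡^ x (suc n) = ≡.cong (x *_) (pow≡^ x n)

  pow-cong : ∀ n {x y} → x ≈ y → pow K x n ≈ pow K y n
  pow-cong n {x} {y} x≈y rewrite pow≡^ x n | pow≡^ y n = ^-congˡ n x≈y

  pow-distrib-* : ∀ x y n → pow K (x * y) n ≈ pow K x n * pow K y n
  pow-distrib-* x y n rewrite pow≡^ (x * y) n | pow≡^ x n | pow≡^ y n = ^-distrib-* x y n

  pow-assoc : ∀ x m n → pow K (pow K x m) n ≈ pow K x (m ℕ.* n)
  pow-assoc x m n rewrite pow≡^ (pow K x m) n | pow≡^ x m | pow≡^ x (m ℕ.* n) = ^-assocʳ x m n

  pow-1# : ∀ n → pow K 1# n ≈ 1#
  pow-1# zero = refl
  pow-1# (suc n) = trans (*-identityˡ _) (pow-1# n)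

  ∏-const : ∀ n x → ∏.sum {n} (λ _ → x) ≈ pow K x n
  ∏-const n x rewrite pow≡^ x n = ∏.sum-replicate n

  pow-2^-suc : ∀ x k → pow K x (2 ℕ.^ suc k) ≈ pow K x (2 ℕ.^ k) * pow K x (2 ℕ.^ k)
  pow-2^-suc x k = begin
    pow K x (2 ℕ.^ suc k)       ≡⟨ ≡.cong (pow K x) (ℕₚ.*-comm 2 (2 ℕ.^ k)) ⟩
    pow K x (2 ℕ.^ k ℕ.* 2)     ≈⟨ pow-assoc x (2 ℕ.^ k) 2 ⟨
    x₁ * (x₁ * 1#)              ≈⟨ *-congˡ (*-identityʳ x₁) ⟩
    x₁ * x₁                     ∎
    where x₁ = pow K x (2 ℕ.^ k)

  pow-2^-+ : ∀ x a b → pow K (pow K x (2 ℕ.^ a)) (2 ℕ.^ b) ≈ pow K x (2 ℕ.^ (a ℕ.+ b))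
  pow-2^-+ x a b = trans (pow-assoc x (2 ℕ.^ a) (2 ℕ.^ b))
    (reflexive (≡.cong (pow K x) (≡.sym (ℕₚ.^-distribˡ-+-* 2 a b))))

  pow-0#-2^ : ∀ k → pow K 0# (2 ℕ.^ k) ≈ 0#
  pow-0#-2^ zero = zeroˡ 1#
  pow-0#-2^ (suc k) = trans (pow-2^-suc 0# k) (trans (*-congʳ (pow-0#-2^ k)) (zeroˡ _))

  *-inverse-cancelˡ : ∀ {x x′} → x * x′ ≈ 1# → ∀ y → x * (x′ * y) ≈ y
  *-inverse-cancelˡ {x} {x′} xx′≈1 y = begin
    x * (x′ * y)  ≈⟨ *-assoc x x′ y ⟨
    (x * x′) * y  ≈⟨ *-congʳ xx′≈1 ⟩
    1# * y        ≈⟨ *-identityˡ y ⟩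
    y             ∎

  *-cancelˡ-nonzero : ∀ {x y z} → ¬ x ≈ 0# → x * y ≈ x * z → y ≈ z
  *-cancelˡ-nonzero {x} {y} {z} x≉0 xy≈xz with inverse x x≉0
  ... | x⁻¹ , xx⁻¹≈1 = begin
    y              ≈⟨ *-inverse-cancelˡ x⁻¹x≈1 y ⟨
    x⁻¹ * (x * y)  ≈⟨ *-congˡ xy≈xz ⟩
    x⁻¹ * (x * z)  ≈⟨ *-inverse-cancelˡ x⁻¹x≈1 z ⟩
    z              ∎
    where
    x⁻¹x≈1 : x⁻¹ * x ≈ 1#
    x⁻¹x≈1 = trans (*-comm x⁻¹ x) xx⁻¹≈1

  *-nonzero : ∀ {x y} → ¬ x ≈ 0# → ¬ y ≈ 0# → ¬ x * y ≈ 0#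
  *-nonzero x≉0 y≉0 xy≈0 = y≉0 (*-cancelˡ-nonzero x≉0 (trans xy≈0 (sym (zeroʳ _))))

  pow-nonzero : ∀ n {x} → ¬ x ≈ 0# → ¬ pow K x n ≈ 0#
  pow-nonzero zero x≉0 = 1≉0
  pow-nonzero (suc n) x≉0 = *-nonzero x≉0 (pow-nonzero n x≉0)

  ∏-nonzero : ∀ {n} (f : Fin n → Carrier) → (∀ i → ¬ f i ≈ 0#) → ¬ ∏.sum f ≈ 0#
  ∏-nonzero {zero} f f≉0 = 1≉0
  ∏-nonzero {suc n} f f≉0 = *-nonzero (f≉0 Fin.zero) (∏-nonzero (f ∘ Fin.suc) (f≉0 ∘ Fin.suc))

  module Subfield (M : ℕ) where

    InSubfield-1# : InSubfield K M 1#
    InSubfield-1# = pow-1# (2 ℕ.^ M)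

    InSubfield-* : ∀ {a b} → InSubfield K M a → InSubfield K M b → InSubfield K M (a * b)
    InSubfield-* {a} {b} a∈ b∈ = trans (pow-distrib-* a b (2 ℕ.^ M)) (*-cong a∈ b∈)

    pow-2^[M*i]-suc : ∀ x i → pow K (pow K x (2 ℕ.^ (M ℕ.* i))) (2 ℕ.^ M) ≈ pow K x (2 ℕ.^ (M ℕ.* suc i))
    pow-2^[M*i]-suc x i =
      trans (pow-2^-+ x (M ℕ.* i) M) (reflexive (≡.cong (pow K x ∘ (2 ℕ.^_)) M*i+M≡M*[1+i]))
      where
      M*i+M≡M*[1+i] : M ℕ.* i ℕ.+ M ≡ M ℕ.* suc i
      M*i+M≡M*[1+i] = ≡.trans (ℕₚ.+-comm (M ℕ.* i) M) (≡.sym (ℕₚ.*-suc M i))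

    pow-2^[M*0] : ∀ x → pow K x (2 ℕ.^ (M ℕ.* 0)) ≈ x
    pow-2^[M*0] x rewrite ℕₚ.*-zeroʳ M = *-identityʳ x

    InSubfield⇒pow-2^[M*i] : ∀ {a} → InSubfield K M a → ∀ i → pow K a (2 ℕ.^ (M ℕ.* i)) ≈ a
    InSubfield⇒pow-2^[M*i] {a} a∈ zero = pow-2^[M*0] a
    InSubfield⇒pow-2^[M*i] {a} a∈ (suc i) = begin
      pow K a (2 ℕ.^ (M ℕ.* suc i))                ≈⟨ pow-2^[M*i]-suc a i ⟨
      pow K (pow K a (2 ℕ.^ (M ℕ.* i))) (2 ℕ.^ M)  ≈⟨ pow-cong (2 ℕ.^ M) (InSubfield⇒pow-2^[M*i] a∈ i) ⟩
      pow K a (2 ℕ.^ M)                            ≈⟨ a∈ ⟩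
      a                                            ∎

  module Characteristic2 (1+1≈0 : 1# + 1# ≈ 0#) where

    x+x≈0 : ∀ x → x + x ≈ 0#
    x+x≈0 x = begin
      x + x            ≈⟨ +-cong (*-identityˡ x) (*-identityˡ x) ⟨
      1# * x + 1# * x  ≈⟨ distribʳ x 1# 1# ⟨
      (1# + 1#) * x    ≈⟨ *-congʳ 1+1≈0 ⟩
      0# * x           ≈⟨ zeroˡ x ⟩
      0#               ∎

    x+y≈0⇒x≈y : ∀ {x y} → x + y ≈ 0# → x ≈ y
    x+y≈0⇒x≈y {x} {y} x+y≈0 = +-cancelʳ y x y (trans x+y≈0 (sym (x+x≈0 y)))

    [x+y]²≈x²+y² : ∀ x y → (x + y) * (x + y) ≈ x * x + y * y
    [x+y]²≈x²+y² x y = begin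
      (x + y) * (x + y)
        ≈⟨ solve 2 (λ x y → (x :+ y) :* (x :+ y) := x :* x :+ (x :* y :+ x :* y) :+ y :* y) refl x y ⟩
      x * x + (x * y + x * y) + y * y  ≈⟨ +-congʳ (+-congˡ (x+x≈0 (x * y))) ⟩
      x * x + 0# + y * y               ≈⟨ +-congʳ (+-identityʳ (x * x)) ⟩
      x * x + y * y                    ∎

    pow-2^-distrib-+ : ∀ k x y → pow K (x + y) (2 ℕ.^ k) ≈ pow K x (2 ℕ.^ k) + pow K y (2 ℕ.^ k)
    pow-2^-distrib-+ zero x y = distribʳ 1# x y
    pow-2^-distrib-+ (suc k) x y = begin
      pow K (x + y) (2 ℕ.^ suc k)                    ≈⟨ pow-2^-suc (x + y) k ⟩
      φ (x + y) * φ (x + y)                          ≈⟨ *-cong (pow-2^-distrib-+ k x y) (pow-2^-distrib-+ k x y) ⟩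
      (φ x + φ y) * (φ x + φ y)                      ≈⟨ [x+y]²≈x²+y² (φ x) (φ y) ⟩
      φ x * φ x + φ y * φ y                          ≈⟨ +-cong (pow-2^-suc x k) (pow-2^-suc y k) ⟨
      pow K x (2 ℕ.^ suc k) + pow K y (2 ℕ.^ suc k)  ∎
      where
      φ : Carrier → Carrier
      φ z = pow K z (2 ℕ.^ k)

    module Trace (M : ℕ) where
      open Subfield M

      InSubfield-+ : ∀ {a b} → InSubfield K M a → InSubfield K M b → InSubfield K M (a + b)
      InSubfield-+ a∈ b∈ = trans (pow-2^-distrib-+ M _ _) (+-cong a∈ b∈)

      trace-cong : ∀ i {x y} → x ≈ y → trace K M i x ≈ trace K M i y
      trace-cong zero x≈y = refl
      trace-cong (suc i) x≈y = +-cong (trace-cong i x≈y) (pow-cong (2 ℕ.^ (M ℕ.* i)) x≈y)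

      trace-+ : ∀ i x y → trace K M i (x + y) ≈ trace K M i x + trace K M i y
      trace-+ zero x y = sym (+-identityˡ 0#)
      trace-+ (suc i) x y = begin
        trace K M i (x + y) + pow K (x + y) j
          ≈⟨ +-cong (trace-+ i x y) (pow-2^-distrib-+ (M ℕ.* i) x y) ⟩
        (trace K M i x + trace K M i y) + (pow K x j + pow K y j)
          ≈⟨ solve 4 (λ a b c d → (a :+ b) :+ (c :+ d) := (a :+ c) :+ (b :+ d)) refl _ _ _ _ ⟩
        (trace K M i x + pow K x j) + (trace K M i y + pow K y j) ∎
        where j = 2 ℕ.^ (M ℕ.* i)

      trace-*ˡ : ∀ {a} → InSubfield K M a → ∀ i x → trace K M i (a * x) ≈ a * trace K M i x
      trace-*ˡ {a} a∈ zero x = sym (zeroʳ a)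
      trace-*ˡ {a} a∈ (suc i) x = begin
        trace K M i (a * x) + pow K (a * x) j      ≈⟨ +-cong (trace-*ˡ a∈ i x) (pow-distrib-* a x j) ⟩
        a * trace K M i x + pow K a j * pow K x j  ≈⟨ +-congˡ (*-congʳ (InSubfield⇒pow-2^[M*i] a∈ i)) ⟩
        a * trace K M i x + a * pow K x j          ≈⟨ distribˡ a _ _ ⟨
        a * (trace K M i x + pow K x j)            ∎
        where j = 2 ℕ.^ (M ℕ.* i)

      trace-square : ∀ i x → trace K M i (x * x) ≈ trace K M i x * trace K M i x
      trace-square zero x = sym (zeroˡ 0#)
      trace-square (suc i) x = begin
        trace K M i (x * x) + pow K (x * x) j
          ≈⟨ +-cong (trace-square i x) (pow-distrib-* x x j) ⟩
        trace K M i x * trace K M i x + pow K x j * pow K x j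
          ≈⟨ [x+y]²≈x²+y² _ _ ⟨
        (trace K M i x + pow K x j) * (trace K M i x + pow K x j) ∎
        where j = 2 ℕ.^ (M ℕ.* i)

      -- The Frobenius x ↦ x^(2^M) shifts the terms of the trace by one.
      pow-2^M-trace : ∀ i x → pow K (trace K M i x) (2 ℕ.^ M) + x ≈ trace K M i x + pow K x (2 ℕ.^ (M ℕ.* i))
      pow-2^M-trace zero x = +-cong (pow-0#-2^ M) (sym (pow-2^[M*0] x))
      pow-2^M-trace (suc i) x = begin
        pow K (trace K M i x + xᵢ) (2 ℕ.^ M) + x
          ≈⟨ +-congʳ (pow-2^-distrib-+ M _ _) ⟩
        (pow K (trace K M i x) (2 ℕ.^ M) + pow K xᵢ (2 ℕ.^ M)) + x
          ≈⟨ solve 3 (λ a b c → (a :+ b) :+ c := (a :+ c) :+ b) refl _ _ _ ⟩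
        (pow K (trace K M i x) (2 ℕ.^ M) + x) + pow K xᵢ (2 ℕ.^ M)
          ≈⟨ +-cong (pow-2^M-trace i x) (pow-2^[M*i]-suc x i) ⟩
        (trace K M i x + xᵢ) + pow K x (2 ℕ.^ (M ℕ.* suc i)) ∎
        where xᵢ = pow K x (2 ℕ.^ (M ℕ.* i))

      trace-InSubfield : ∀ n → (∀ x → pow K x (2 ℕ.^ (M ℕ.* n)) ≈ x) → ∀ x → InSubfield K M (trace K M n x)
      trace-InSubfield n fermat x =
        +-cancelʳ x _ _ (trans (pow-2^M-trace n x) (+-congˡ (fermat x)))

      trace-even : ∀ {a} → InSubfield K M a → ∀ j → trace K M (j ℕ.+ j) a ≈ 0#
      trace-even a∈ zero = refl
      trace-even {a} a∈ (suc j) = begin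
        trace K M (suc (j ℕ.+ suc j)) a
          ≡⟨ ≡.cong (λ i → trace K M (suc i) a) (ℕₚ.+-suc j j) ⟩
        (trace K M (j ℕ.+ j) a + pow K a (2 ℕ.^ (M ℕ.* (j ℕ.+ j)))) + pow K a (2 ℕ.^ (M ℕ.* suc (j ℕ.+ j)))
          ≈⟨ +-cong (+-cong (trace-even a∈ j) (InSubfield⇒pow-2^[M*i] a∈ _)) (InSubfield⇒pow-2^[M*i] a∈ _) ⟩
        (0# + a) + a  ≈⟨ +-congʳ (+-identityˡ a) ⟩
        a + a         ≈⟨ x+x≈0 a ⟩
        0#            ∎

      trace-odd : ∀ {a} → InSubfield K M a → ∀ k → trace K M (suc (2 ℕ.* k)) a ≈ a
      trace-odd {a} a∈ k = begin
        trace K M (suc (2 ℕ.* k)) a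
          ≡⟨ ≡.cong (λ i → trace K M (suc (k ℕ.+ i)) a) (ℕₚ.+-identityʳ k) ⟩
        trace K M (k ℕ.+ k) a + pow K a (2 ℕ.^ (M ℕ.* (k ℕ.+ k)))
          ≈⟨ +-cong (trace-even a∈ k) (InSubfield⇒pow-2^[M*i] a∈ _) ⟩
        0# + a  ≈⟨ +-identityˡ a ⟩
        a       ∎

    module TraceMap (M k : ℕ) (u : Carrier) (u∈ : InSubfield K M u)
                    (fermat : ∀ x → pow K x (2 ℕ.^ (M ℕ.* suc (2 ℕ.* k))) ≈ x)
                    (_≟_ : ∀ x y → Dec (x ≈ y)) where
      open Subfield M
      open Trace M

      n : ℕ
      n = suc (2 ℕ.* k)

      T : Carrier → Carrier
      T = trace K M n

      G : Carrier → Carrier → Carrier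
      G w x = (x * ((u * T x) + (u * x))) + (w * x)

      T∈ : ∀ x → InSubfield K M (T x)
      T∈ = trace-InSubfield n fermat

      -- The two quadratic terms have the same trace u·T(x)² and cancel.
      trace-G : ∀ {w} → InSubfield K M w → ∀ x → T (G w x) ≈ w * T x
      trace-G {w} w∈ x = begin
        T (G w x)
          ≈⟨ trace-cong n (solve 4 (λ x u t w → x :* (u :* t :+ u :* x) :+ w :* x
                                             := (u :* t) :* x :+ (u :* (x :* x) :+ w :* x)) refl x u (T x) w) ⟩
        T ((u * T x) * x + (u * (x * x) + w * x))
          ≈⟨ trans (trace-+ n _ _) (+-congˡ (trace-+ n _ _)) ⟩
        T ((u * T x) * x) + (T (u * (x * x)) + T (w * x))
          ≈⟨ +-cong (trace-*ˡ (InSubfield-* u∈ (T∈ x)) n x) (+-cong (trace-*ˡ u∈ n (x * x)) (trace-*ˡ w∈ n x)) ⟩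
        (u * T x) * T x + (u * T (x * x) + w * T x)
          ≈⟨ +-congˡ (+-congʳ (*-congˡ (trace-square n x))) ⟩
        (u * T x) * T x + (u * (T x * T x) + w * T x)
          ≈⟨ solve 3 (λ u t w → (u :* t) :* t :+ (u :* (t :* t) :+ w :* t)
                             := ((u :* t) :* t :+ (u :* t) :* t) :+ w :* t) refl u (T x) w ⟩
        ((u * T x) * T x + (u * T x) * T x) + w * T x
          ≈⟨ +-congʳ (x+x≈0 _) ⟩
        0# + w * T x  ≈⟨ +-identityˡ _ ⟩
        w * T x       ∎

      G-+ : ∀ w {x y} → T x ≈ T y → G w x + G w y ≈ (x + y) * ((u * T x + w) + u * (x + y))
      G-+ w {x} {y} Tx≈Ty = begin
        G w x + G w y
          ≈⟨ +-congˡ (+-congʳ (*-congˡ (+-congʳ (*-congˡ Tx≈Ty)))) ⟨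
        (x * (u * t + u * x) + w * x) + (y * (u * t + u * y) + w * y)
          ≈⟨ solve 5 (λ x y u t w → (x :* (u :* t :+ u :* x) :+ w :* x) :+ (y :* (u :* t :+ u :* y) :+ w :* y)
                                 := (x :+ y) :* (u :* t :+ w) :+ u :* (x :* x :+ y :* y)) refl x y u t w ⟩
        (x + y) * (u * t + w) + u * (x * x + y * y)
          ≈⟨ +-congˡ (*-congˡ ([x+y]²≈x²+y² x y)) ⟨
        (x + y) * (u * t + w) + u * ((x + y) * (x + y))
          ≈⟨ solve 4 (λ d u t w → d :* (u :* t :+ w) :+ u :* (d :* d)
                               := d :* ((u :* t :+ w) :+ u :* d)) refl (x + y) u t w ⟩
        (x + y) * ((u * t + w) + u * (x + y)) ∎
        where t = T x

      G-+-factor-nonzero : ∀ {w} → InSubfield K M w → ¬ w ≈ 0# → ∀ {x y} → T x ≈ T y → ¬ x + y ≈ 0# →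
                           ¬ (u * T x + w) + u * (x + y) ≈ 0#
      G-+-factor-nonzero {w} w∈ w≉0 {x} {y} Tx≈Ty x+y≉0 c≈0 = by-cases (u ≟ 0#)
        where
        uTx+w≈u[x+y] : u * T x + w ≈ u * (x + y)
        uTx+w≈u[x+y] = x+y≈0⇒x≈y c≈0
        uTx+w≈0 : u * T x + w ≈ 0#
        uTx+w≈0 = begin
          u * T x + w      ≈⟨ trace-odd (InSubfield-+ (InSubfield-* u∈ (T∈ x)) w∈) k ⟨
          T (u * T x + w)  ≈⟨ trace-cong n uTx+w≈u[x+y] ⟩
          T (u * (x + y))  ≈⟨ trace-*ˡ u∈ n (x + y) ⟩
          u * T (x + y)    ≈⟨ *-congˡ (trace-+ n x y) ⟩
          u * (T x + T y)  ≈⟨ *-congˡ (trans (+-congˡ (sym Tx≈Ty)) (x+x≈0 (T x))) ⟩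
          u * 0#           ≈⟨ zeroʳ u ⟩
          0#               ∎
        by-cases : Dec (u ≈ 0#) → ⊥
        by-cases (no u≉0) = *-nonzero u≉0 x+y≉0 (trans (sym uTx+w≈u[x+y]) uTx+w≈0)
        by-cases (yes u≈0) = w≉0 (begin
          w            ≈⟨ +-identityˡ w ⟨
          0# + w       ≈⟨ +-congʳ (trans (*-congʳ u≈0) (zeroˡ (T x))) ⟨
          u * T x + w  ≈⟨ uTx+w≈0 ⟩
          0#           ∎)

      G-injective : ∀ {w} → InSubfield K M w → ¬ w ≈ 0# → ∀ x y → G w x ≈ G w y → x ≈ y
      G-injective {w} w∈ w≉0 x y Gx≈Gy with (x + y) ≟ 0#
      ... | yes x+y≈0 = x+y≈0⇒x≈y x+y≈0
      ... | no x+y≉0 = contradiction product≈0 (*-nonzero x+y≉0 (G-+-factor-nonzero w∈ w≉0 Tx≈Ty x+y≉0))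
        where
        Tx≈Ty : T x ≈ T y
        Tx≈Ty = *-cancelˡ-nonzero w≉0 (trans (sym (trace-G w∈ x)) (trans (trace-cong n Gx≈Gy) (trace-G w∈ y)))
        product≈0 : (x + y) * ((u * T x + w) + u * (x + y)) ≈ 0#
        product≈0 = trans (sym (G-+ w Tx≈Ty)) (trans (+-congʳ Gx≈Gy) (x+x≈0 (G w y)))

      G+id≈G[+1#] : ∀ w x → G w x + x ≈ G (w + 1#) x
      G+id≈G[+1#] w x =
        solve 3 (λ x a w → (x :* a :+ w :* x) :+ x := x :* a :+ (w :+ con 1) :* x) refl x (u * T x + u * x) w

  module Finite {q} (card : HasCard K q) where
    element : Fin q → Carrier
    element = proj₁ card

    index : Carrier → Fin q
    index x = proj₁ (proj₂ (proj₂ card) x)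

    element-index : ∀ x → element (index x) ≈ x
    element-index x = proj₂ (proj₂ (proj₂ card) x)

    index-unique : ∀ {i x} → element i ≈ x → index x ≡ i
    index-unique {i} {x} eᵢ≈x = proj₁ (proj₂ card) _ _ (trans (element-index x) (sym eᵢ≈x))

    index-injective : ∀ {x y} → index x ≡ index y → x ≈ y
    index-injective {x} {y} ix≡iy =
      trans (sym (element-index x)) (trans (reflexive (≡.cong element ix≡iy)) (element-index y))

    _≟_ : ∀ x y → Dec (x ≈ y)
    x ≟ y with index x Fin.≟ index y
    ... | yes ix≡iy = yes (index-injective ix≡iy)
    ... | no ix≢iy = no (λ x≈y → ix≢iy (index-unique (trans (element-index y) (sym x≈y))))

    injective⇒permutation : ∀ f → (∀ x y → f x ≈ f y → x ≈ y) → IsPermutation K f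
    injective⇒permutation f f-injective = f-injective , surjective
      where
      surjective : ∀ y → ∃ λ x → f x ≈ y
      surjective y with injective⇒surjective (index ∘ f ∘ element) f̂-injective (index y)
        where
        f̂-injective : ∀ i j → index (f (element i)) ≡ index (f (element j)) → i ≡ j
        f̂-injective i j = proj₁ (proj₂ card) i j ∘ f-injective _ _ ∘ index-injective
      ... | i , f̂ᵢ≡iy = element i , index-injective f̂ᵢ≡iy

    module Reindex {φ ψ : Carrier → Carrier}
                   (φ-cong : ∀ {x y} → x ≈ y → φ x ≈ φ y) (ψ-cong : ∀ {x y} → x ≈ y → ψ x ≈ ψ y)
                   (φ∘ψ≈id : ∀ x → φ (ψ x) ≈ x) (ψ∘φ≈id : ∀ x → ψ (φ x) ≈ x) where

      reindexing : Permutation q q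
      reindexing = mk↔ₛ′ (index ∘ φ ∘ element) (index ∘ ψ ∘ element)
        (λ j → index-unique (sym (trans (φ-cong (element-index _)) (φ∘ψ≈id (element j)))))
        (λ i → index-unique (sym (trans (ψ-cong (element-index _)) (ψ∘φ≈id (element i)))))

      sum-∘-bijection : (CM : CommutativeMonoid 0ℓ 0ℓ) → let module CM = CommutativeMonoid CM in
                        (h : Carrier → CM.Carrier) → (∀ {x y} → x ≈ y → h x CM.≈ h y) →
                        Sum.sum CM (h ∘ element) CM.≈ Sum.sum CM (h ∘ φ ∘ element)
      sum-∘-bijection CM h h-cong = CM.trans (∑-permute (h ∘ element) reindexing)
          (sum-cong-≋ (λ i → h-cong (element-index (φ (element i)))))
        where
        module CM = CommutativeMonoid CM
        open Sum CM using (∑-permute; sum-cong-≋)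

    q×1#≈0# : q × 1# ≈ 0#
    q×1#≈0# = +-identityˡ-unique (q × 1#) S (begin
      q × 1# + S                     ≈⟨ +-congʳ (∑.sum-replicate q) ⟨
      ∑.sum {q} (λ _ → 1#) + S       ≈⟨ ∑.∑-distrib-+ (λ _ → 1#) element ⟨
      ∑.sum (λ i → 1# + element i)   ≈⟨ sum-∘-bijection +-commutativeMonoid id id ⟨
      S                              ∎)
      where
      S = ∑.sum element
      translate-inverseˡ : ∀ x → 1# + (- 1# + x) ≈ x
      translate-inverseˡ = RingProperties.\\-leftDividesˡ ring 1#
      translate-inverseʳ : ∀ x → - 1# + (1# + x) ≈ x
      translate-inverseʳ = RingProperties.\\-leftDividesʳ ring 1#
      open Reindex {1# +_} { - 1# +_} +-congˡ +-congˡ translate-inverseˡ translate-inverseʳ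

    zeroTo : Carrier → Carrier → Carrier
    zeroTo c y with y ≟ 0#
    ... | yes _ = c
    ... | no _ = y

    zeroTo-zero : ∀ {c y} → y ≈ 0# → zeroTo c y ≈ c
    zeroTo-zero {c} {y} y≈0 with y ≟ 0#
    ... | yes _ = refl
    ... | no y≉0 = contradiction y≈0 y≉0

    zeroTo-nonzero : ∀ {c y} → ¬ y ≈ 0# → zeroTo c y ≈ y
    zeroTo-nonzero {c} {y} y≉0 with y ≟ 0#
    ... | yes y≈0 = contradiction y≈0 y≉0
    ... | no _ = refl

    zeroTo-cong : ∀ {c y z} → y ≈ z → zeroTo c y ≈ zeroTo c z
    zeroTo-cong {c} {y} {z} y≈z = by-cases (y ≟ 0#)
      where
      by-cases : Dec (y ≈ 0#) → zeroTo c y ≈ zeroTo c z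
      by-cases (yes y≈0) = trans (zeroTo-zero y≈0) (sym (zeroTo-zero (trans (sym y≈z) y≈0)))
      by-cases (no y≉0) = trans (zeroTo-nonzero y≉0) (trans y≈z (sym (zeroTo-nonzero (y≉0 ∘ trans y≈z))))

    zeroTo-* : ∀ {x} → ¬ x ≈ 0# → ∀ y → zeroTo x (x * y) ≈ x * zeroTo 1# y
    zeroTo-* {x} x≉0 y = by-cases (y ≟ 0#)
      where
      by-cases : Dec (y ≈ 0#) → zeroTo x (x * y) ≈ x * zeroTo 1# y
      by-cases (yes y≈0) = begin
        zeroTo x (x * y)  ≈⟨ zeroTo-zero (trans (*-congˡ y≈0) (zeroʳ x)) ⟩
        x                 ≈⟨ *-identityʳ x ⟨
        x * 1#            ≈⟨ *-congˡ (zeroTo-zero y≈0) ⟨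
        x * zeroTo 1# y   ∎
      by-cases (no y≉0) = trans (zeroTo-nonzero (*-nonzero x≉0 y≉0)) (*-congˡ (sym (zeroTo-nonzero y≉0)))

    ∏-zeroTo-scale : ∀ {x} → ¬ x ≈ 0# →
                     ∏.sum (zeroTo x ∘ element) ≈ pow K x q * ∏.sum (zeroTo 1# ∘ element)
    ∏-zeroTo-scale {x} x≉0 with inverse x x≉0
    ... | x⁻¹ , xx⁻¹≈1 = begin
      ∏.sum (zeroTo x ∘ element)                      ≈⟨ sum-∘-bijection *-commutativeMonoid (zeroTo x) zeroTo-cong ⟩
      ∏.sum (zeroTo x ∘ (x *_) ∘ element)             ≈⟨ ∏.sum-cong-≋ (zeroTo-* x≉0 ∘ element) ⟩
      ∏.sum (λ i → x * zeroTo 1# (element i))         ≈⟨ ∏.∑-distrib-+ (λ _ → x) (zeroTo 1# ∘ element) ⟩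
      ∏.sum {q} (λ _ → x) * ∏.sum (zeroTo 1# ∘ element) ≈⟨ *-congʳ (∏-const q x) ⟩
      pow K x q * ∏.sum (zeroTo 1# ∘ element)         ∎
      where
      open Reindex {x *_} {x⁻¹ *_} *-congˡ *-congˡ (*-inverse-cancelˡ xx⁻¹≈1)
        (*-inverse-cancelˡ (trans (*-comm x⁻¹ x) xx⁻¹≈1))

  -- Multiplication by x ≠ 0 permutes K, and zeroTo makes every factor nonzero, so comparing
  -- the products of zeroTo x and zeroTo 1# cancels the product of the nonzero elements.
  module Fermat {q} (card : HasCard K (suc q)) where
    open Finite card

    punchIn-nonzero : ∀ j → ¬ element (Fin.punchIn (index 0#) j) ≈ 0#
    punchIn-nonzero j eⱼ≈0 = Finₚ.punchInᵢ≢i (index 0#) j (≡.sym (index-unique eⱼ≈0))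

    nonzeroProduct : Carrier
    nonzeroProduct = ∏.sum (element ∘ Fin.punchIn (index 0#))

    ∏-zeroTo : ∀ c → ∏.sum (zeroTo c ∘ element) ≈ c * nonzeroProduct
    ∏-zeroTo c = trans (∏.sum-remove {i = index 0#} (zeroTo c ∘ element))
      (*-cong (zeroTo-zero (element-index 0#)) (∏.sum-cong-≋ (zeroTo-nonzero ∘ punchIn-nonzero)))

    pow-card : ∀ x → pow K x (suc q) ≈ x
    pow-card x with x ≟ 0#
    ... | yes x≈0 = trans (pow-cong (suc q) x≈0) (trans (zeroˡ _) (sym x≈0))
    ... | no x≉0 = *-cancelˡ-nonzero (∏-nonzero _ punchIn-nonzero) (begin
      P * pow K x (suc q)                            ≈⟨ *-comm P _ ⟩
      pow K x (suc q) * P                            ≈⟨ *-congˡ (*-identityˡ P) ⟨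
      pow K x (suc q) * (1# * P)                     ≈⟨ *-congˡ (∏-zeroTo 1#) ⟨
      pow K x (suc q) * ∏.sum (zeroTo 1# ∘ element)  ≈⟨ ∏-zeroTo-scale x≉0 ⟨
      ∏.sum (zeroTo x ∘ element)                     ≈⟨ ∏-zeroTo x ⟩
      x * P                                          ≈⟨ *-comm x P ⟩
      P * x                                          ∎)
      where P = nonzeroProduct

  fermat : ∀ {q} → HasCard K q → ∀ x → pow K x q ≈ x
  fermat {zero} card x = ⊥-elim (Finₚ.¬Fin0 (Finite.index card x))
  fermat {suc q} card = Fermat.pow-card card

  2^N×1#≈[1#+1#]^N : ∀ N → (2 ℕ.^ N) × 1# ≈ pow K (1# + 1#) N
  2^N×1#≈[1#+1#]^N zero = +-identityʳ 1#
  2^N×1#≈[1#+1#]^N (suc N) = trans (×1-homo-* 2 (2 ℕ.^ N))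
    (*-cong (+-congˡ (+-identityʳ 1#)) (2^N×1#≈[1#+1#]^N N))

  characteristic-2 : ∀ {N} → HasCard K (2 ℕ.^ N) → 1# + 1# ≈ 0#
  characteristic-2 {N} card with Finite._≟_ card (1# + 1#) 0#
  ... | yes 1+1≈0 = 1+1≈0
  ... | no 1+1≉0 =
    contradiction (trans (sym (2^N×1#≈[1#+1#]^N N)) (Finite.q×1#≈0# card)) (pow-nonzero N 1+1≉0)

corollary4 : (K : Field) → (m k : ℕ) →
    let open Field K
        n = suc (2 ℕ.* k)
    in HasCard K (2 ℕ.^ (suc m ℕ.* n)) →
       (u v : Carrier) →
       InSubfield K (suc m) u →
       InSubfield K (suc m) v →
       ¬ (v ≈ 0#) → ¬ (v ≈ 1#) →
       IsCompletePermutation K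
         (λ x → (x * ((u * trace K (suc m) n x) + (u * x))) + (v * x))
corollary4 K m k card u v u∈ v∈ v≉0 v≉1 =
    injective⇒permutation (G v) (G-injective v∈ v≉0)
  , injective⇒permutation (λ x → G v x + x) G+id-injective
  where
  open Field K
  open Finite K card using (_≟_; injective⇒permutation)
  open Characteristic2 K (characteristic-2 K {suc m ℕ.* suc (2 ℕ.* k)} card)
  open Subfield K (suc m) using (InSubfield-1#)
  open Trace (suc m) using (InSubfield-+)
  open TraceMap (suc m) k u u∈ (fermat K card) _≟_

  G+id-injective : ∀ x y → G v x + x ≈ G v y + y → x ≈ y
  G+id-injective x y eq = G-injective (InSubfield-+ v∈ InSubfield-1#) (v≉1 ∘ x+y≈0⇒x≈y) x y
    (trans (sym (G+id≈G[+1#] v x)) (trans eq (G+id≈G[+1#] v y)))
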